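{- Every connected graph with $b>0$ branches has max leaf number at most $2b$.
   Context: The max leaf number of a connected graph $G$ is the maximum, over all spanning trees of $G$, of the number of leaves of the spanning tree. A branch of $G$ is a maximal path or cycle in $G$ in which every internal vertex of the path has degree two in $G$. -}

module Defs where

open import Data.Nat using (ℕ; zero; suc; _+_; _≤_; _≡ᵇ_)
open import Data.Fin using (Fin)
open import Data.Bool using (Bool; true; false; if_then_else_)
open import Data.List using (List; []; _∷_; _++_; length)
open import Data.List.Relation.Unary.All using (All)
open import Data.List.Relation.Unary.Unique.Propositional using (Unique)
open import Data.List.Relation.Unary.AllPairs using (AllPairs)
open import Data.List.Membership.Propositional using (_∈_)
open import Data.Product using (Σ; ∃; ∃-syntax; _×_; _,_)
open import Data.Sum using (_⊎_)
open import Relation.Binary.PropositionalEquality using (_≡_; _≢_)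
open import Relation.Nullary using (¬_)

Adjacency : ℕ → Set
Adjacency n = Fin n → Fin n → Bool

record Graph : Set where
  field
    n      : ℕ
    adj    : Adjacency n
    sym    : ∀ u v → adj u v ≡ adj v u
    irrefl : ∀ v → adj v v ≡ false

countTrue : ∀ {n} → (Fin n → Bool) → ℕ
countTrue {zero}  p = 0
countTrue {suc n} p = (if p Fin.zero then 1 else 0) + countTrue (λ i → p (Fin.suc i))

degree : ∀ {n} → Adjacency n → Fin n → ℕ
degree A u = countTrue (A u)

data Walk {n} (A : Adjacency n) : List (Fin n) → Set where
  nil  : Walk A []
  one  : ∀ x → Walk A (x ∷ [])
  cons : ∀ {x y xs} → A x y ≡ true → Walk A (y ∷ xs) → Walk A (x ∷ y ∷ xs)

data Reach {n} (A : Adjacency n) : Fin n → Fin n → Set where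
  here : ∀ {u} → Reach A u u
  step : ∀ {u w v} → A u w ≡ true → Reach A w v → Reach A u v

Connected : ∀ {n} → Adjacency n → Set
Connected {n} A = ∀ (u v : Fin n) → Reach A u v

seq : ∀ {n} → Fin n → List (Fin n) → Fin n → List (Fin n)
seq a mid z = a ∷ (mid ++ z ∷ [])

IsCycle : ∀ {n} → Adjacency n → Fin n → List (Fin n) → Set
IsCycle A a mid = Walk A (seq a mid a) × Unique (a ∷ mid) × 2 ≤ length mid

IsPath : ∀ {n} → Adjacency n → Fin n → List (Fin n) → Fin n → Set
IsPath A a mid z = Walk A (seq a mid z) × Unique (seq a mid z) × a ≢ z

Acyclic : ∀ {n} → Adjacency n → Set
Acyclic A = ∀ a mid → ¬ IsCycle A a mid

record SpanningTree (G : Graph) : Set where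
  open Graph G
  field
    tadj      : Adjacency n
    tsym      : ∀ u v → tadj u v ≡ tadj v u
    tsub      : ∀ u v → tadj u v ≡ true → adj u v ≡ true
    connected : Connected tadj
    acyclic   : Acyclic tadj

leaves : ∀ {G} → SpanningTree G → ℕ
leaves T = countTrue (λ v → degree (SpanningTree.tadj T) v ≡ᵇ 1)

-- A path or cycle of G all of whose internal vertices have degree two in G.
-- Paths: a ≢ z, internal vertices = mid.  Cycles: a ≡ z, internal = mid.
record Candidate (G : Graph) : Set where
  open Graph G
  field
    start : Fin n
    mid   : List (Fin n)
    end   : Fin n
    pathOrCycle : IsPath adj start mid end ⊎ (start ≡ end × IsCycle adj start mid)
    internalDeg2 : All (λ v → degree adj v ≡ 2) mid

data Consec {n} : List (Fin n) → Fin n → Fin n → Set where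
  hd : ∀ {x y xs} → Consec (x ∷ y ∷ xs) x y
  tl : ∀ {x xs u v} → Consec xs u v → Consec (x ∷ xs) u v

EdgeIn : ∀ {G} → Candidate G → Fin (Graph.n G) → Fin (Graph.n G) → Set
EdgeIn c u v = Consec s u v ⊎ Consec s v u
  where s = seq (Candidate.start c) (Candidate.mid c) (Candidate.end c)

_⊆E_ : ∀ {G} → Candidate G → Candidate G → Set
_⊆E_ {G} c d = ∀ (u v : Fin (Graph.n G)) → EdgeIn c u v → EdgeIn d u v

_≈E_ : ∀ {G} → Candidate G → Candidate G → Set
c ≈E d = (c ⊆E d) × (d ⊆E c)

IsBranch : ∀ {G} → Candidate G → Set
IsBranch {G} c = ∀ (d : Candidate G) → c ⊆E d → d ⊆E c

Branch : Graph → Set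
Branch G = Σ (Candidate G) IsBranch

-- G has exactly b branches (branches counted as subgraphs, i.e. up to
-- having the same edge set).
HasBranchCount : Graph → ℕ → Set
HasBranchCount G b =
  ∃[ bs ] (length bs ≡ b
          × AllPairs (λ (x y : Branch G) → ¬ (Σ.proj₁ x ≈E Σ.proj₁ y)) bs
          × (∀ (x : Branch G) → ∃[ y ] (y ∈ bs × Σ.proj₁ x ≈E Σ.proj₁ y)))
  where open Data.Product

module Submission where

-- Every leaf of a spanning tree T of G lies on a branch of G, and every branch
-- contains at most two leaves of T; hence T has at most 2b leaves.
--
-- Branch walks:  a branch is read as a walk x 0, …, x m whose interior vertices
--   have degree two in G.  The key lemma is that a segment x lo, …, x hi which T
--   cannot leave at either end (a missing tree edge, or an end vertex that is a
--   leaf) is closed under T-adjacency, hence everything by connectivity of T.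
--   Consequently T misses at most one edge of the walk, and the leaves of T on
--   the walk are the two ends of that missing edge, or the two ends of the walk
--   when nothing is missing (a closed walk cannot lie in the acyclic T).
-- Maximality:  ordering candidates by their number of edges, every path or
--   cycle with degree-two interior (in particular a single tree edge at a leaf)
--   extends, classically, to a branch.  The conclusion is a decidable
--   statement, so the classical reasoning happens in the double-negation monad.
-- Finally, listing the two leaf positions of each of the b branches gives a
-- list of length 2b containing every leaf of T.

open import Defs
open import Data.Nat using (ℕ; zero; suc; _+_; _*_; _∸_; _≤_; _<_; _≡ᵇ_; z≤n; s≤s)
open import Data.Nat.Properties using (+-suc; *-suc; +-comm; ≤-refl; ≤-trans; ≤-reflexive; n≤1+n; +-mono-≤; +-mono-<-≤;
  +-mono-≤-<; <⇒≤; ≤-pred; ≤∧≢⇒<; m≤n⇒m<n∨m≡n; 1+n≰n; ≤-<-trans; <-cmp; anyUpTo?; ∸-monoʳ-<; ≡ᵇ⇒≡)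
  renaming (_≟_ to _≟ℕ_)
open import Data.Nat.Induction using (<-wellFounded)
open import Data.Bool using (Bool; true; false; if_then_else_) renaming (T to IsTrue)
open import Data.Bool.Properties using (¬-not) renaming (_≟_ to _≟ᵇ_)
open import Data.Unit using (tt)
open import Data.Empty using (⊥; ⊥-elim)
open import Data.Fin using (Fin; zero; suc; _≟_)
open import Data.List using (List; []; _∷_; _++_; length)
open import Data.List.Properties using (length-++)
open import Data.List.Relation.Unary.All using (All; []; _∷_) renaming (lookup to lookupAll)
open import Data.List.Relation.Unary.AllPairs using ([]; _∷_)
open import Data.List.Relation.Unary.Unique.Propositional using (Unique)
open import Data.List.Relation.Unary.Any using (here; there)
open import Data.List.Membership.Propositional using (_∈_)
open import Data.Product using (∃; _×_; _,_; proj₁; proj₂)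
open import Data.Sum using (_⊎_; inj₁; inj₂; [_,_]′)
import Data.Sum
import Induction.WellFounded as WF
open import Relation.Binary using (tri<; tri≈; tri>)
import Relation.Binary.Construct.On as On
open import Relation.Binary.PropositionalEquality
open import Relation.Nullary using (¬_; Dec; does; yes; no; contradiction)
open import Relation.Nullary.Decidable using (decidable-stable; dec-true; dec-false; _⊎-dec_; ¬¬-excluded-middle)
open import Relation.Nullary.Negation using (¬¬-Monad)
open import Effect.Monad using (RawMonad)
open import Level using (0ℓ)

module Counting where

  private
    variable
      n : ℕ

  remove : (Fin n → Bool) → Fin n → Fin n → Bool
  remove p a x = if does (x ≟ a) then false else p x

  remove-other : ∀ (p : Fin n → Bool) {a x} → x ≢ a → remove p a x ≡ p x
  remove-other p {a} {x} x≢a with x ≟ a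
  ... | yes x≡a = contradiction x≡a x≢a
  ... | no _    = refl

  count-remove : ∀ (p : Fin n → Bool) a → p a ≡ true → countTrue p ≡ suc (countTrue (remove p a))
  count-remove p zero    pa rewrite pa = refl
  count-remove p (suc a) pa = trans (cong ((if p zero then 1 else 0) +_) (count-remove (λ i → p (suc i)) a pa)) (+-suc _ _)

  count-mono : ∀ (p q : Fin n → Bool) → (∀ x → p x ≡ true → q x ≡ true) → countTrue p ≤ countTrue q
  count-mono {zero}  p q p⇒q = z≤n
  count-mono {suc n} p q p⇒q with p zero in p0 | q zero in q0
  ... | true  | true  = s≤s (count-mono _ _ (λ i → p⇒q (suc i)))
  ... | true  | false = contradiction (trans (sym (p⇒q zero p0)) q0) λ ()
  ... | false | true  = ≤-trans (count-mono _ _ (λ i → p⇒q (suc i))) (n≤1+n _)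
  ... | false | false = count-mono _ _ (λ i → p⇒q (suc i))

  count-strict : ∀ (p q : Fin n → Bool) a → (∀ x → p x ≡ true → q x ≡ true) →
                 p a ≡ false → q a ≡ true → countTrue p < countTrue q
  count-strict p q a p⇒q pa qa = begin-strict
    countTrue p              ≤⟨ count-mono p (remove q a) p⇒q-a ⟩
    countTrue (remove q a)   <⟨ ≤-refl ⟩
    suc (countTrue (remove q a)) ≡⟨ sym (count-remove q a qa) ⟩
    countTrue q              ∎
    where
      open Data.Nat.Properties.≤-Reasoning
      p⇒q-a : ∀ x → p x ≡ true → remove q a x ≡ true
      p⇒q-a x px = trans (remove-other q (λ { refl → contradiction (trans (sym px) pa) λ () })) (p⇒q x px)

  count-≤-size : ∀ (p : Fin n → Bool) → countTrue p ≤ n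
  count-≤-size {zero}  p = z≤n
  count-≤-size {suc n} p with p zero
  ... | true  = s≤s (count-≤-size _)
  ... | false = ≤-trans (count-≤-size _) (n≤1+n _)

  count-≥-distinct : ∀ (p : Fin n → Bool) xs → Unique xs → All (λ x → p x ≡ true) xs → length xs ≤ countTrue p
  count-≥-distinct p []       _           _          = z≤n
  count-≥-distinct p (a ∷ xs) (a∉xs ∷ u) (pa ∷ pxs) = begin
    suc (length xs)              ≤⟨ s≤s (count-≥-distinct (remove p a) xs u (still-true a∉xs pxs)) ⟩
    suc (countTrue (remove p a)) ≡⟨ sym (count-remove p a pa) ⟩
    countTrue p                  ∎
    where
      open Data.Nat.Properties.≤-Reasoning
      still-true : ∀ {ys} → All (a ≢_) ys → All (λ y → p y ≡ true) ys → All (λ y → remove p a y ≡ true) ys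
      still-true []           []         = []
      still-true (a≢y ∷ a≢ys) (py ∷ pys) = trans (remove-other p (λ y≡a → a≢y (sym y≡a))) py ∷ still-true a≢ys pys

  count-≤-cover : ∀ (p : Fin n → Bool) xs → (∀ x → p x ≡ true → x ∈ xs) → countTrue p ≤ length xs
  count-≤-cover {n} p [] cover = ≤-trans (count-mono p (λ _ → false) (λ x px → contradiction (cover x px) λ ()))
                                         (≤-reflexive (count-false n))
    where
      count-false : ∀ k → countTrue {k} (λ _ → false) ≡ 0
      count-false zero    = refl
      count-false (suc k) = count-false k
  count-≤-cover p (a ∷ xs) cover = ≤-trans without-a (s≤s (count-≤-cover (remove p a) xs cover-rest))
    where
      cover-rest : ∀ x → remove p a x ≡ true → x ∈ xs
      cover-rest x rx with x ≟ a
      ... | no x≢a with cover x rx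
      ...   | here x≡a   = contradiction x≡a x≢a
      ...   | there x∈xs = x∈xs
      without-a : countTrue p ≤ suc (countTrue (remove p a))
      without-a with p a in pa
      ... | true  = ≤-reflexive (count-remove p a pa)
      ... | false = ≤-trans (count-mono p (remove p a) keep) (n≤1+n _)
        where
          keep : ∀ x → p x ≡ true → remove p a x ≡ true
          keep x px = trans (remove-other p (λ { refl → contradiction (trans (sym px) pa) λ () })) px

  single-point : ∀ (p : Fin n → Bool) {a b} → countTrue p ≡ 1 → p a ≡ true → p b ≡ true → a ≡ b
  single-point p {a} {b} c≡1 pa pb with a ≟ b
  ... | yes a≡b = a≡b
  ... | no a≢b  with ≤-trans (count-≥-distinct p (a ∷ b ∷ []) ((a≢b ∷ []) ∷ [] ∷ []) (pa ∷ pb ∷ [])) (≤-reflexive c≡1)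
  ...   | s≤s ()

  two-points : ∀ (p : Fin n → Bool) {a b w} → countTrue p ≡ 2 → a ≢ b →
               p a ≡ true → p b ≡ true → p w ≡ true → w ≡ a ⊎ w ≡ b
  two-points p {a} {b} {w} c≡2 a≢b pa pb pw with w ≟ a | w ≟ b
  ... | yes w≡a | _       = inj₁ w≡a
  ... | no _    | yes w≡b = inj₂ w≡b
  ... | no w≢a  | no w≢b  with ≤-trans (count-≥-distinct p (a ∷ b ∷ w ∷ [])
                                          ((a≢b ∷ ≢-sym w≢a ∷ []) ∷ (≢-sym w≢b ∷ []) ∷ [] ∷ [])
                                          (pa ∷ pb ∷ pw ∷ []))
                                        (≤-reflexive c≡2)
  ...   | s≤s (s≤s ())

  sumFin : (Fin n → ℕ) → ℕ
  sumFin {zero}  f = 0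
  sumFin {suc n} f = f zero + sumFin (λ i → f (suc i))

  sumFin-mono : ∀ (f g : Fin n → ℕ) → (∀ x → f x ≤ g x) → sumFin f ≤ sumFin g
  sumFin-mono {zero}  f g f≤g = z≤n
  sumFin-mono {suc n} f g f≤g = +-mono-≤ (f≤g zero) (sumFin-mono _ _ (λ i → f≤g (suc i)))

  sumFin-strict : ∀ (f g : Fin n → ℕ) a → (∀ x → f x ≤ g x) → f a < g a → sumFin f < sumFin g
  sumFin-strict {suc n} f g zero    f≤g fa<ga = +-mono-<-≤ fa<ga (sumFin-mono _ _ (λ i → f≤g (suc i)))
  sumFin-strict {suc n} f g (suc a) f≤g fa<ga = +-mono-≤-< (f≤g zero) (sumFin-strict _ _ a (λ i → f≤g (suc i)) fa<ga)

  sumFin-bound : ∀ k (f : Fin n → ℕ) → (∀ x → f x ≤ k) → sumFin f ≤ n * k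
  sumFin-bound {zero}  k f f≤k = z≤n
  sumFin-bound {suc n} k f f≤k = +-mono-≤ (f≤k zero) (sumFin-bound k _ (λ i → f≤k (suc i)))

module Indexing {A : Set} (default : A) where

  at : List A → ℕ → A
  at []       _       = default
  at (y ∷ ys) zero    = y
  at (y ∷ ys) (suc j) = at ys j

  at-∈ : ∀ ys {j} → j < length ys → at ys j ∈ ys
  at-∈ (y ∷ ys) {zero}  _         = here refl
  at-∈ (y ∷ ys) {suc j} (s≤s j<l) = there (at-∈ ys j<l)

  ∈-at : ∀ {ys v} → v ∈ ys → ∃ λ j → j < length ys × v ≡ at ys j
  ∈-at (here refl) = 0 , s≤s z≤n , refl
  ∈-at (there v∈ys) with ∈-at v∈ys
  ... | j , j<l , eq = suc j , s≤s j<l , eq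

  ≢-at : ∀ {y zs} → All (y ≢_) zs → ∀ {j} → j < length zs → y ≢ at zs j
  ≢-at (y≢z ∷ _)  {zero}  _         = y≢z
  ≢-at (_ ∷ y∉zs) {suc j} (s≤s j<l) = ≢-at y∉zs j<l

  unique-at : ∀ {ys} → Unique ys → ∀ {i j} → i < length ys → j < length ys → at ys i ≡ at ys j → i ≡ j
  unique-at _           {zero}  {zero}  _         _         _  = refl
  unique-at (y∉ys ∷ _)  {zero}  {suc j} _         (s≤s j<l) eq = contradiction eq (≢-at y∉ys j<l)
  unique-at (y∉ys ∷ _)  {suc i} {zero}  (s≤s i<l) _         eq = contradiction (sym eq) (≢-at y∉ys i<l)
  unique-at (_ ∷ u)     {suc i} {suc j} (s≤s i<l) (s≤s j<l) eq = cong suc (unique-at u i<l j<l eq)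

  at-++ˡ : ∀ xs ys {j} → j < length xs → at (xs ++ ys) j ≡ at xs j
  at-++ˡ (x ∷ xs) ys {zero}  _         = refl
  at-++ˡ (x ∷ xs) ys {suc j} (s≤s j<l) = at-++ˡ xs ys j<l

  at-last : ∀ xs z → at (xs ++ z ∷ []) (length xs) ≡ z
  at-last []       z = refl
  at-last (x ∷ xs) z = at-last xs z

module WalkIndexing {n} {A : Adjacency n} (default : Fin n) where
  open Indexing default

  walk-at : ∀ {ys} → Walk A ys → ∀ {j} → suc j < length ys → A (at ys j) (at ys (suc j)) ≡ true
  walk-at (cons xy _) {zero}  _           = xy
  walk-at (cons _ w)  {suc j} (s≤s j+1<l) = walk-at w j+1<l
  walk-at (one _)     {_}     (s≤s ())

  at-walk : ∀ ys → (∀ j → suc j < length ys → A (at ys j) (at ys (suc j)) ≡ true) → Walk A ys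
  at-walk []           _        = nil
  at-walk (y ∷ [])     _        = one y
  at-walk (y ∷ z ∷ ys) adjacent = cons (adjacent 0 (s≤s (s≤s z≤n))) (at-walk (z ∷ ys) (λ j lt → adjacent (suc j) (s≤s lt)))

open Counting
open WalkIndexing

closed-set-is-everything : ∀ {n} {A : Adjacency n} → Connected A → (P : Fin n → Set) →
                           (∀ {u w} → P u → A u w ≡ true → P w) → ∀ {u} → P u → ∀ w → P w
closed-set-is-everything {A = A} connected P closed {u} pu w = follow (connected u w) pu
  where
    follow : ∀ {a b} → Reach A a b → P a → P b
    follow here         pa = pa
    follow (step ab rb) pa = follow rb (closed pa ab)

positive-is-suc : ∀ {i k} → i < k → ∃ λ h → k ≡ suc h
positive-is-suc {k = suc h} _ = h , refl

IsLeaf : ∀ {G} → SpanningTree G → Fin (Graph.n G) → Set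
IsLeaf T v = degree (SpanningTree.tadj T) v ≡ 1

InjectiveUpTo : ∀ {A : Set} → ℕ → (ℕ → A) → Set
InjectiveUpTo m x = ∀ j k → j ≤ m → k ≤ m → x j ≡ x k → j ≡ k

module _ (G : Graph) where
  open Graph G

  record BranchWalk : Set where
    field
      m                : ℕ
      x                : ℕ → Fin n
      adjacent         : ∀ j → j < m → adj (x j) (x (suc j)) ≡ true
      interior-degree  : ∀ j → suc j < m → degree adj (x (suc j)) ≡ 2
      interior-unique  : ∀ j k → suc j < m → k ≤ m → x (suc j) ≡ x k → suc j ≡ k
      shape            : InjectiveUpTo m x ⊎ (x 0 ≡ x m × 3 ≤ m)

-- Besides the shape of B,
-- the argument only uses that T is connected, and (via cycle-broken, a
-- consequence of acyclicity) that T cannot contain every edge of a closed B.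
module BranchInTree (G : Graph) (T : SpanningTree G) (B : BranchWalk G)
  (cycle-broken : BranchWalk.x B 0 ≡ BranchWalk.x B (BranchWalk.m B) →
                  ¬ (∀ j → j < BranchWalk.m B →
                       SpanningTree.tadj T (BranchWalk.x B j) (BranchWalk.x B (suc j)) ≡ true))
  where
  open Graph G using (n; adj)
  open SpanningTree T
  open BranchWalk B

  Leaf : Fin n → Set
  Leaf = IsLeaf T

  inTree : ℕ → Bool
  inTree j = tadj (x j) (x (suc j))

  tree-flip : ∀ {u v} → tadj u v ≡ true → tadj v u ≡ true
  tree-flip {u} {v} = trans (tsym v u)

  leaf-neighbour-unique : ∀ {u a b} → Leaf u → tadj u a ≡ true → tadj u b ≡ true → a ≡ b
  leaf-neighbour-unique {u} = single-point (tadj u)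

  walk-neighbours-distinct : ∀ j → suc j < m → x j ≢ x (suc (suc j))
  walk-neighbours-distinct (suc j) j+2<m eq
    with () ← interior-unique j (suc (suc (suc j))) (≤-trans (n≤1+n _) j+2<m) j+2<m eq
  walk-neighbours-distinct zero 1<m eq with shape
  ... | inj₁ injective     with () ← injective 0 2 z≤n 1<m eq
  ... | inj₂ (_ , 3≤m)     with () ← interior-unique 1 0 3≤m z≤n (sym eq)

  -- An interior vertex has degree two in G, so its tree neighbours are among
  -- its two walk-neighbours.
  interior-tree-neighbour : ∀ j → suc j < m → ∀ {w} → tadj (x (suc j)) w ≡ true →
                            w ≡ x j ⊎ w ≡ x (suc (suc j))
  interior-tree-neighbour j j+1<m t =
    two-points (adj (x (suc j))) (interior-degree j j+1<m) (walk-neighbours-distinct j j+1<m)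
      (trans (Graph.sym G _ _) (adjacent j (<⇒≤ j+1<m))) (adjacent (suc j) j+1<m) (tsub _ _ t)

  interior-not-leaf : ∀ j → suc j < m → inTree j ≡ true → inTree (suc j) ≡ true → ¬ Leaf (x (suc j))
  interior-not-leaf j j+1<m back forward leaf =
    walk-neighbours-distinct j j+1<m (leaf-neighbour-unique leaf (tree-flip back) forward)

  Segment : ℕ → ℕ → Fin n → Set
  Segment lo hi w = ∃ λ j → lo ≤ j × j ≤ hi × w ≡ x j

  -- T cannot leave the segment through its left end: either the edge entering
  -- it is missing from T, or the segment starts at x 0 whose only tree neighbour is x 1.
  SealedLeft : ℕ → ℕ → Set
  SealedLeft lo hi = (∃ λ l → lo ≡ suc l × inTree l ≡ false)
                   ⊎ (lo ≡ 0 × 1 ≤ hi × (∀ {w} → tadj (x 0) w ≡ true → w ≡ x 1))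

  SealedRight : ℕ → ℕ → Set
  SealedRight lo hi = (hi < m × inTree hi ≡ false)
                    ⊎ (∃ λ h → m ≡ suc h × hi ≡ m × lo ≤ h × (∀ {w} → tadj (x m) w ≡ true → w ≡ x h))

  step-back : ∀ {lo hi} j → SealedLeft lo hi → lo ≤ suc j → suc j ≤ hi →
              tadj (x (suc j)) (x j) ≡ true → Segment lo hi (x j)
  step-back j (inj₂ (refl , _)) _ j+1≤hi t = j , z≤n , ≤-trans (n≤1+n j) j+1≤hi , refl
  step-back j (inj₁ (l , refl , missing)) lo≤j+1 j+1≤hi t with l ≟ℕ j
  ... | yes refl = contradiction (trans (sym missing) (tree-flip t)) λ ()
  ... | no l≢j   = j , ≤∧≢⇒< (≤-pred lo≤j+1) l≢j , ≤-trans (n≤1+n j) j+1≤hi , refl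

  step-forward : ∀ {lo hi} j → SealedRight lo hi → suc j < m → lo ≤ suc j → suc j ≤ hi →
                 tadj (x (suc j)) (x (suc (suc j))) ≡ true → Segment lo hi (x (suc (suc j)))
  step-forward j (inj₂ (_ , _ , refl , _)) j+1<m lo≤j+1 _ t =
    suc (suc j) , ≤-trans lo≤j+1 (n≤1+n _) , j+1<m , refl
  step-forward {hi = hi} j (inj₁ (_ , missing)) _ lo≤j+1 j+1≤hi t with hi ≟ℕ suc j
  ... | yes refl  = contradiction (trans (sym missing) t) λ ()
  ... | no hi≢j+1 = suc (suc j) , ≤-trans lo≤j+1 (n≤1+n _) , ≤∧≢⇒< j+1≤hi (≢-sym hi≢j+1) , refl

  sealed-segment-closed : ∀ {lo hi u w} → hi ≤ m → SealedLeft lo hi → SealedRight lo hi →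
                          Segment lo hi u → tadj u w ≡ true → Segment lo hi w
  sealed-segment-closed _ (inj₁ (_ , refl , _)) _ (zero , () , _)
  sealed-segment-closed _ (inj₂ (refl , 1≤hi , only-x₁)) _ (zero , _ , _ , refl) t = 1 , z≤n , 1≤hi , only-x₁ t
  sealed-segment-closed hi≤m left right (suc j , lo≤j+1 , j+1≤hi , refl) t
    with m≤n⇒m<n∨m≡n (≤-trans j+1≤hi hi≤m)
  ... | inj₁ j+1<m with interior-tree-neighbour j j+1<m t
  ...   | inj₁ refl = step-back j left lo≤j+1 j+1≤hi t
  ...   | inj₂ refl = step-forward j right j+1<m lo≤j+1 j+1≤hi t
  sealed-segment-closed _ _ (inj₁ (hi<m , _)) (suc j , _ , j+1≤hi , refl) t | inj₂ refl =
    contradiction (≤-trans hi<m j+1≤hi) 1+n≰n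
  sealed-segment-closed _ _ (inj₂ (h , refl , refl , lo≤h , only-xₕ)) (suc j , _ , _ , refl) t | inj₂ refl =
    h , lo≤h , n≤1+n h , only-xₕ t

  sealed-segment-is-everything : ∀ {lo hi} → lo ≤ hi → hi ≤ m →
                                 SealedLeft lo hi → SealedRight lo hi → ∀ w → Segment lo hi w
  sealed-segment-is-everything {lo} {hi} lo≤hi hi≤m left right =
    closed-set-is-everything connected (Segment lo hi) (sealed-segment-closed hi≤m left right)
      (lo , ≤-refl , lo≤hi , refl)

  -- Two edges of the walk missing from T would seal off the vertices between
  -- them, which exclude x 0.
  two-missing-impossible : ∀ {i k} → i < k → k < m → inTree i ≡ false → inTree k ≡ false → ⊥
  two-missing-impossible {i} {k} i<k k<m missing-i missing-k
    with sealed-segment-is-everything i<k (<⇒≤ k<m) (inj₁ (i , refl , missing-i)) (inj₁ (k<m , missing-k)) (x 0)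
  ... | suc j , _ , j+1≤k , x₀≡xⱼ₊₁ with () ← interior-unique j 0 (≤-<-trans j+1≤k k<m) z≤n (sym x₀≡xⱼ₊₁)

  -- On a path, if edge 0 is in T but a later edge i is not, then x 0 is not a
  -- leaf: otherwise x 0, …, x i would be sealed off from x (suc i).
  path-start-not-leaf : InjectiveUpTo m x → ∀ {i} → 1 ≤ i → i < m →
                        inTree i ≡ false → inTree 0 ≡ true → ¬ Leaf (x 0)
  path-start-not-leaf injective {i} 1≤i i<m missing first leaf
    with sealed-segment-is-everything z≤n (<⇒≤ i<m) left (inj₁ (i<m , missing)) (x (suc i))
    where
      left : SealedLeft 0 i
      left = inj₂ (refl , 1≤i , λ t → leaf-neighbour-unique leaf t first)
  ... | j , _ , j≤i , eq with injective (suc i) j i<m (≤-trans j≤i (<⇒≤ i<m)) eq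
  ...   | refl = 1+n≰n j≤i

  last-edge : ∀ {h} → m ≡ suc h → inTree h ≡ true → tadj (x m) (x h) ≡ true
  last-edge refl = tree-flip

  path-end-not-leaf : InjectiveUpTo m x → ∀ {i h} → m ≡ suc h → suc i < m →
                      inTree i ≡ false → inTree h ≡ true → ¬ Leaf (x m)
  path-end-not-leaf injective {i} {h} m≡h+1 i+1<m missing final leaf
    with sealed-segment-is-everything (<⇒≤ i+1<m) ≤-refl (inj₁ (i , refl , missing)) right (x i)
    where
      right : SealedRight (suc i) m
      right = inj₂ (h , m≡h+1 , refl , ≤-pred (subst (suc i <_) m≡h+1 i+1<m) ,
                    λ t → leaf-neighbour-unique leaf t (last-edge m≡h+1 final))
  ... | j , i+1≤j , j≤m , eq with injective i j (≤-trans (n≤1+n i) (<⇒≤ i+1<m)) j≤m eq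
  ...   | refl = 1+n≰n i+1≤j

  LeavesAmong : Fin n → Fin n → Set
  LeavesAmong a b = ∀ j → j ≤ m → Leaf (x j) → x j ≡ a ⊎ x j ≡ b

  all-edges-in-tree : (∀ j → j < m → inTree j ≡ true) → LeavesAmong (x 0) (x m)
  all-edges-in-tree all-in with shape
  ... | inj₂ (closed , _) = ⊥-elim (cycle-broken closed all-in)
  ... | inj₁ _ = at-ends
    where
      at-ends : LeavesAmong (x 0) (x m)
      at-ends zero    _      _    = inj₁ refl
      at-ends (suc j) j+1≤m leaf with m≤n⇒m<n∨m≡n j+1≤m
      ... | inj₂ j+1≡m = inj₂ (cong x j+1≡m)
      ... | inj₁ j+1<m = ⊥-elim (interior-not-leaf j j+1<m (all-in j (<⇒≤ j+1<m)) (all-in (suc j) j+1<m) leaf)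

  other-edges-in-tree : ∀ {i} → i < m → inTree i ≡ false → ∀ j → j < m → j ≢ i → inTree j ≡ true
  other-edges-in-tree {i} i<m missing j j<m j≢i with inTree j in e
  ... | true  = refl
  ... | false with <-cmp i j
  ...   | tri< i<j _ _ = ⊥-elim (two-missing-impossible i<j j<m missing e)
  ...   | tri≈ _ i≡j _ = ⊥-elim (j≢i (sym i≡j))
  ...   | tri> _ _ j<i = ⊥-elim (two-missing-impossible j<i i<m e missing)

  -- On a cycle, x 0 = x m with both end edges in T has the two distinct tree
  -- neighbours x 1 and x h, so it is not a leaf.
  cycle-base-not-leaf : x 0 ≡ x m → 3 ≤ m → ∀ {h} → m ≡ suc h →
                        inTree 0 ≡ true → inTree h ≡ true → ¬ Leaf (x 0)
  cycle-base-not-leaf closed 3≤m {h} m≡h+1 first final leaf = neighbours-distinct (leaf-neighbour-unique leaf first last)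
    where
      last : tadj (x 0) (x h) ≡ true
      last = subst (λ v → tadj v (x h) ≡ true) (sym closed) (last-edge m≡h+1 final)
      neighbours-distinct : x 1 ≢ x h
      neighbours-distinct eq with interior-unique 0 h (≤-trans (s≤s (s≤s z≤n)) 3≤m)
                                    (subst (h ≤_) (sym m≡h+1) (n≤1+n h)) eq
      ... | 1≡h = contradiction (subst (3 ≤_) (trans m≡h+1 (cong suc (sym 1≡h))) 3≤m) λ { (s≤s (s≤s ())) }

  -- If T misses only edge i ≢ 0, then x 0 can be a leaf only as an end of edge i:
  -- on a path x 0 is sealed off, and on a cycle x 0 = x m.
  start-leaf : ∀ {i} → i < m → inTree i ≡ false → i ≢ 0 → Leaf (x 0) → x 0 ≡ x i ⊎ x 0 ≡ x (suc i)
  start-leaf {i} i<m missing i≢0 leaf with shape | positive-is-suc i<m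
  ... | inj₁ injective | _ =
    ⊥-elim (path-start-not-leaf injective (≤∧≢⇒< z≤n (≢-sym i≢0)) i<m missing first leaf)
    where
      first : inTree 0 ≡ true
      first = other-edges-in-tree i<m missing 0 (≤-<-trans z≤n i<m) (≢-sym i≢0)
  ... | inj₂ (closed , 3≤m) | h , m≡h+1 with h ≟ℕ i
  ...   | yes h≡i = inj₂ (trans closed (trans (cong x m≡h+1) (cong (λ k → x (suc k)) h≡i)))
  ...   | no h≢i  = ⊥-elim (cycle-base-not-leaf closed 3≤m m≡h+1 first final leaf)
    where
      first : inTree 0 ≡ true
      first = other-edges-in-tree i<m missing 0 (≤-<-trans z≤n i<m) (≢-sym i≢0)
      final : inTree h ≡ true
      final = other-edges-in-tree i<m missing h (subst (h <_) (sym m≡h+1) ≤-refl) h≢i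

  -- Symmetrically for x m when suc i ≢ m; on a cycle x m = x 0.
  end-leaf : ∀ {i} → i < m → inTree i ≡ false → suc i ≢ m → Leaf (x m) → x m ≡ x i ⊎ x m ≡ x (suc i)
  end-leaf {i} i<m missing i+1≢m leaf with shape | positive-is-suc i<m
  ... | inj₁ injective | h , m≡h+1 =
    ⊥-elim (path-end-not-leaf injective m≡h+1 (≤∧≢⇒< i<m i+1≢m) missing final leaf)
    where
      final : inTree h ≡ true
      final = other-edges-in-tree i<m missing h (subst (h <_) (sym m≡h+1) ≤-refl)
                (λ h≡i → i+1≢m (trans (cong suc (sym h≡i)) (sym m≡h+1)))
  ... | inj₂ (closed , _) | _ with i ≟ℕ 0
  ...   | yes refl = inj₁ (sym closed)
  ...   | no i≢0   = Data.Sum.map (trans (sym closed)) (trans (sym closed))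
                       (start-leaf i<m missing i≢0 (subst Leaf (sym closed) leaf))

  one-edge-missing : ∀ i → i < m → inTree i ≡ false → LeavesAmong (x i) (x (suc i))
  one-edge-missing i i<m missing j j≤m leaf with j ≟ℕ i | j ≟ℕ suc i
  ... | yes refl | _        = inj₁ refl
  ... | no _     | yes refl = inj₂ refl
  one-edge-missing i i<m missing zero    _     leaf | no 0≢i | no _ = start-leaf i<m missing (≢-sym 0≢i) leaf
  one-edge-missing i i<m missing (suc j) j+1≤m leaf | no j+1≢i | no j+1≢i+1 with m≤n⇒m<n∨m≡n j+1≤m
  ... | inj₂ refl  = end-leaf i<m missing (≢-sym j+1≢i+1) leaf
  ... | inj₁ j+1<m = ⊥-elim (interior-not-leaf j j+1<m back forward leaf)
    where
      back : inTree j ≡ true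
      back = other-edges-in-tree i<m missing j (<⇒≤ j+1<m) (λ j≡i → j+1≢i+1 (cong suc j≡i))
      forward : inTree (suc j) ≡ true
      forward = other-edges-in-tree i<m missing (suc j) j+1<m j+1≢i

  two-leaf-positions : ∃ λ a → ∃ λ b → LeavesAmong a b
  two-leaf-positions with anyUpTo? (λ j → inTree j ≟ᵇ false) m
  ... | yes (i , i<m , missing) = x i , x (suc i) , one-edge-missing i i<m missing
  ... | no none = x 0 , x m , all-edges-in-tree (λ j j<m → ¬-not (λ missing → none (j , j<m , missing)))

module CandidateWalk {G : Graph} (c : Candidate G) where
  open Graph G using (n; adj)
  open Candidate c renaming (start to a; end to z)
  open Indexing a

  vertices : List (Fin n)
  vertices = seq a mid z

  m : ℕ
  m = suc (length mid)

  x : ℕ → Fin n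
  x = at vertices

  length-vertices : length vertices ≡ suc m
  length-vertices = cong suc (trans (length-++ mid) (+-comm (length mid) 1))

  position : ∀ {j} → j ≤ m → j < length vertices
  position {j} j≤m = subst (j <_) (sym length-vertices) (s≤s j≤m)

  x-last : x m ≡ z
  x-last = at-last mid z

  x-initial : ∀ {j} → j < m → x j ≡ at (a ∷ mid) j
  x-initial = at-++ˡ (a ∷ mid) (z ∷ [])

  walk : Walk adj vertices
  walk = [ proj₁ , (λ { (a≡z , cycle) → subst (λ t → Walk adj (seq a mid t)) a≡z (proj₁ cycle) }) ]′ pathOrCycle

  path-injective : IsPath adj a mid z → InjectiveUpTo m x
  path-injective (_ , unique , _) j k j≤m k≤m = unique-at unique (position j≤m) (position k≤m)

  cycle-injective : Unique (a ∷ mid) → ∀ {j k} → j < m → k < m → x j ≡ x k → j ≡ k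
  cycle-injective unique j<m k<m eq = unique-at unique j<m k<m (trans (sym (x-initial j<m)) (trans eq (x-initial k<m)))

  interior-unique : ∀ j k → suc j < m → k ≤ m → x (suc j) ≡ x k → suc j ≡ k
  interior-unique j k j+1<m k≤m eq with pathOrCycle
  ... | inj₁ path = path-injective path (suc j) k (<⇒≤ j+1<m) k≤m eq
  ... | inj₂ (a≡z , _ , unique , _) with m≤n⇒m<n∨m≡n k≤m
  ...   | inj₁ k<m = cycle-injective unique j+1<m k<m eq
  ...   | inj₂ refl with () ← cycle-injective unique j+1<m (s≤s z≤n) (trans eq (trans x-last (sym a≡z)))

  shape : InjectiveUpTo m x ⊎ (x 0 ≡ x m × 3 ≤ m)
  shape = [ (λ path → inj₁ (path-injective path)) ,
            (λ { (a≡z , _ , _ , 2≤mid) → inj₂ (trans a≡z (sym x-last) , s≤s 2≤mid) }) ]′ pathOrCycle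

  interior-degree : ∀ j → suc j < m → degree adj (x (suc j)) ≡ 2
  interior-degree j (s≤s j<mid) =
    subst (λ v → degree adj v ≡ 2) (sym (at-++ˡ mid (z ∷ []) j<mid)) (lookupAll internalDeg2 (at-∈ mid j<mid))

  branchWalk : BranchWalk G
  branchWalk = record
    { m               = m
    ; x               = x
    ; adjacent        = λ j j<m → walk-at a walk (position j<m)
    ; interior-degree = interior-degree
    ; interior-unique = interior-unique
    ; shape           = shape
    }

  vertex-position : ∀ {v} → v ∈ vertices → ∃ λ j → j ≤ m × v ≡ x j
  vertex-position v∈vs with ∈-at v∈vs
  ... | j , j<l , eq = j , ≤-pred (subst (j <_) length-vertices j<l) , eq

  closed-not-in-tree : (T : SpanningTree G) → x 0 ≡ x m →
                       ¬ (∀ j → j < m → SpanningTree.tadj T (x j) (x (suc j)) ≡ true)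
  closed-not-in-tree T closed all-in with pathOrCycle
  ... | inj₁ (_ , _ , a≢z) = a≢z (trans closed x-last)
  ... | inj₂ (a≡z , _ , unique , 2≤mid) =
    SpanningTree.acyclic T a mid (subst (λ t → Walk _ (seq a mid t)) (sym a≡z) tree-walk , unique , 2≤mid)
    where
      tree-walk : Walk (SpanningTree.tadj T) vertices
      tree-walk = at-walk a vertices (λ j j+1<l → all-in j (≤-pred (subst (suc j <_) length-vertices j+1<l)))

candidate-leaves : (G : Graph) (T : SpanningTree G) (c : Candidate G) →
                   ∃ λ a → ∃ λ b → ∀ {v} → v ∈ CandidateWalk.vertices c → IsLeaf T v → v ≡ a ⊎ v ≡ b
candidate-leaves G T c = among-positions two-leaf-positions
  where
    open CandidateWalk c
    open BranchInTree G T branchWalk (closed-not-in-tree T)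

    among-positions : (∃ λ a → ∃ λ b → LeavesAmong a b) →
                      ∃ λ a → ∃ λ b → ∀ {v} → v ∈ vertices → Leaf v → v ≡ a ⊎ v ≡ b
    among-positions (a , b , among) = a , b , on-walk
      where
        on-walk : ∀ {v} → v ∈ vertices → Leaf v → v ≡ a ⊎ v ≡ b
        on-walk v∈vs leaf with vertex-position v∈vs
        ... | j , j≤m , refl = among j j≤m leaf

-- Candidates are ordered by their number of
-- edges, which is bounded; since the existence of a strictly larger candidate is
-- not decidable, the extension exists in the double-negation monad.
module Maximality (G : Graph) where
  open Graph G using (n)
  open RawMonad (¬¬-Monad {a = 0ℓ})

  does-sound : ∀ {P : Set} (p? : Dec P) → does p? ≡ true → P
  does-sound (yes p) _ = p

  consec? : ∀ (l : List (Fin n)) u v → Dec (Consec l u v)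
  consec? []           u v = no λ ()
  consec? (y ∷ [])     u v = no λ { (tl ()) }
  consec? (y ∷ z ∷ l)  u v with consec? (z ∷ l) u v
  ... | yes later = yes (tl later)
  ... | no ¬later with y ≟ u | z ≟ v
  ...   | yes refl | yes refl = yes hd
  ...   | no y≢u   | _        = no λ { hd → y≢u refl ; (tl later) → ¬later later }
  ...   | yes _    | no z≢v   = no λ { hd → z≢v refl ; (tl later) → ¬later later }

  edge? : ∀ (c : Candidate G) u v → Dec (EdgeIn c u v)
  edge? c u v = consec? _ u v ⊎-dec consec? _ v u

  edgeCount : Candidate G → ℕ
  edgeCount c = sumFin (λ u → countTrue (λ v → does (edge? c u v)))

  edgeCount-bound : ∀ c → edgeCount c ≤ n * n
  edgeCount-bound c = sumFin-bound {n} n _ (λ u → count-≤-size _)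

  edgeCount-strict : ∀ {c d u v} → c ⊆E d → EdgeIn d u v → ¬ EdgeIn c u v → edgeCount c < edgeCount d
  edgeCount-strict {c} {d} {u} {v} c⊆d uv∈d uv∉c =
    sumFin-strict _ _ u (λ u′ → count-mono _ _ (included u′))
      (count-strict _ _ v (included u) (dec-false (edge? c u v) uv∉c) (dec-true (edge? d u v) uv∈d))
    where
      included : ∀ u′ v′ → does (edge? c u′ v′) ≡ true → does (edge? d u′ v′) ≡ true
      included u′ v′ e = dec-true (edge? d u′ v′) (c⊆d u′ v′ (does-sound (edge? c u′ v′) e))

  ⊆E-stable : ∀ {c d : Candidate G} → ¬ ¬ (c ⊆E d) → c ⊆E d
  ⊆E-stable {d = d} ¬¬c⊆d u v uv∈c =
    decidable-stable (edge? d u v) (λ uv∉d → ¬¬c⊆d (λ c⊆d → uv∉d (c⊆d u v uv∈c)))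

  extra-edge : ∀ {c d : Candidate G} → ¬ (d ⊆E c) → ¬ ¬ (∃ λ u → ∃ λ v → EdgeIn d u v × ¬ EdgeIn c u v)
  extra-edge {c} d⊈c no-witness =
    d⊈c (λ u v uv∈d → decidable-stable (edge? c u v) (λ uv∉c → no-witness (u , v , uv∈d , uv∉c)))

  headroom : Candidate G → ℕ
  headroom c = n * n ∸ edgeCount c

  Extendable : Candidate G → Set
  Extendable c = ¬ ¬ (∃ λ d → IsBranch d × c ⊆E d)

  -- By well-founded induction on headroom: either c is maximal, i.e. a branch,
  -- or some candidate with strictly more edges contains it.
  extend-to-branch : ∀ c → Extendable c
  extend-to-branch = WF.All.wfRec (On.wellFounded headroom <-wellFounded) 0ℓ Extendable extend-step
    where
      extend-step : ∀ c → (∀ {d} → headroom d < headroom c → Extendable d) → Extendable c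
      extend-step c extend-smaller = ¬¬-excluded-middle {A = ∃ λ d → c ⊆E d × ¬ (d ⊆E c)} >>= λ where
        (yes (d , c⊆d , d⊈c)) →
          extra-edge {c} {d} d⊈c >>= λ (u , v , uv∈d , uv∉c) →
          extend-smaller {d} (∸-monoʳ-< (edgeCount-strict {c} {d} c⊆d uv∈d uv∉c) (edgeCount-bound d))
            >>= λ (e , branch , d⊆e) →
          pure (e , branch , λ u′ v′ uv′∈c → d⊆e u′ v′ (c⊆d u′ v′ uv′∈c))
        (no maximal) →
          pure (c , (λ d c⊆d → ⊆E-stable {d} {c} (λ d⊈c → maximal (d , c⊆d , d⊈c))) , λ _ _ uv∈c → uv∈c)

module LeafBound (G : Graph) (T : SpanningTree G) where
  open Graph G using (n; adj; irrefl)
  open SpanningTree T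
  open Maximality G using (extend-to-branch)
  open RawMonad (¬¬-Monad {a = 0ℓ})
  open import Data.List.Membership.DecPropositional (_≟_ {n}) using (_∈?_)

  Leaf : Fin n → Set
  Leaf = IsLeaf T

  leaf-sound : ∀ v → (degree tadj v ≡ᵇ 1) ≡ true → Leaf v
  leaf-sound v isLeaf = ≡ᵇ⇒≡ (degree tadj v) 1 (subst IsTrue (sym isLeaf) tt)

  leaf-neighbour : ∀ {v} → Leaf v → ¬ ¬ (∃ λ w → tadj v w ≡ true)
  leaf-neighbour {v} leaf isolated =
    contradiction (subst (_≤ 0) leaf (count-≤-cover (tadj v) [] (λ w t → ⊥-elim (isolated (w , t))))) λ ()

  tree-edge : ∀ v w → tadj v w ≡ true → Candidate G
  tree-edge v w t = record
    { start        = v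
    ; mid          = []
    ; end          = w
    ; pathOrCycle  = inj₁ (cons (tsub v w t) (one w) , (v≢w ∷ []) ∷ [] ∷ [] , v≢w)
    ; internalDeg2 = []
    }
    where
      v≢w : v ≢ w
      v≢w refl = contradiction (trans (sym (tsub v v t)) (irrefl v)) λ ()

  leaf-on-branch : ∀ {v} → Leaf v → ¬ ¬ (∃ λ d → IsBranch d × ∃ λ w → EdgeIn d v w)
  leaf-on-branch {v} leaf =
    leaf-neighbour leaf >>= λ (w , t) →
    extend-to-branch (tree-edge v w t) >>= λ (d , branch , edge⊆d) →
    pure (d , branch , w , edge⊆d v w (inj₁ hd))

  edge-end-∈ : ∀ (c : Candidate G) {u v} → EdgeIn c u v → u ∈ CandidateWalk.vertices c
  edge-end-∈ c = [ first , second ]′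
    where
      first : ∀ {l : List (Fin n)} {u v} → Consec l u v → u ∈ l
      first hd       = here refl
      first (tl uv)  = there (first uv)
      second : ∀ {l : List (Fin n)} {u v} → Consec l v u → u ∈ l
      second hd      = there (here refl)
      second (tl uv) = there (second uv)

  leaf-positions : List (Branch G) → List (Fin n)
  leaf-positions []             = []
  leaf-positions ((c , _) ∷ bs) =
    proj₁ (candidate-leaves G T c) ∷ proj₁ (proj₂ (candidate-leaves G T c)) ∷ leaf-positions bs

  length-leaf-positions : ∀ bs → length (leaf-positions bs) ≡ 2 * length bs
  length-leaf-positions []       = refl
  length-leaf-positions (_ ∷ bs) =
    trans (cong (λ k → suc (suc k)) (length-leaf-positions bs)) (sym (*-suc 2 (length bs)))

  leaf-positions-complete : ∀ {bs y v} → y ∈ bs → v ∈ CandidateWalk.vertices (proj₁ y) → Leaf v →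
                            v ∈ leaf-positions bs
  leaf-positions-complete {(c , _) ∷ _} (here refl) v∈c leaf with proj₂ (proj₂ (candidate-leaves G T c)) v∈c leaf
  ... | inj₁ refl = here refl
  ... | inj₂ refl = there (here refl)
  leaf-positions-complete {_ ∷ _} (there y∈bs) v∈y leaf = there (there (leaf-positions-complete y∈bs v∈y leaf))

  leaves-bound : (bs : List (Branch G)) → (∀ (d : Branch G) → ∃ λ y → y ∈ bs × proj₁ d ≈E proj₁ y) →
                 leaves T ≤ 2 * length bs
  leaves-bound bs complete = begin
    leaves T                     ≤⟨ count-≤-cover _ (leaf-positions bs) covered ⟩
    length (leaf-positions bs)   ≡⟨ length-leaf-positions bs ⟩
    2 * length bs                ∎
    where
      open Data.Nat.Properties.≤-Reasoning
      covered : ∀ v → (degree tadj v ≡ᵇ 1) ≡ true → v ∈ leaf-positions bs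
      covered v isLeaf = decidable-stable (v ∈? leaf-positions bs)
        (leaf-on-branch leaf >>= λ (d , branch , w , vw∈d) → pure (on-listed-branch d branch vw∈d))
        where
          leaf : Leaf v
          leaf = leaf-sound v isLeaf
          on-listed-branch : ∀ d → IsBranch d → ∀ {w} → EdgeIn d v w → v ∈ leaf-positions bs
          on-listed-branch d branch vw∈d with complete (d , branch)
          ... | y , y∈bs , d⊆y , _ =
            leaf-positions-complete y∈bs (edge-end-∈ (proj₁ y) (d⊆y _ _ vw∈d)) leaf

mainTheorem4 : (G : Graph) → Connected (Graph.adj G) → (b : ℕ) → HasBranchCount G b → 0 < b
    → (T : SpanningTree G) → leaves T ≤ 2 * b
mainTheorem4 G _ b (bs , length≡b , _ , complete) _ T =
  subst (λ k → leaves T ≤ 2 * k) length≡b (LeafBound.leaves-bound G T bs complete)
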